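{- The languages $\mathcal{L}_1$ and $\mathcal{L}_2$ are equally expressive: $\mathcal{L}_2$ is a fragment of $\mathcal{L}_1$, and for every formula $\varphi\in\mathcal{L}_1$ there is a formula $t(\varphi)\in\mathcal{L}_2$ such that for every model $\mathcal{M}$ and state $s$, $\mathcal{M},s\vDash\varphi$ iff $\mathcal{M},s\vDash t(\varphi)$.
   Context: Fix a set of constants $\mathbb{C}$. The language $\mathcal{L}_1$ is given by $\varphi ::= \top \mid \lnot\varphi \mid \varphi\land\varphi \mid \mathit{Kv}(c) \mid [c]\varphi$ with $c\in\mathbb{C}$. A model is a triple $\mathcal{M}=\langle S,\mathcal{D},V\rangle$ with $S$ a non-empty set of states, $\mathcal{D}$ a non-empty domain and $V:S\times\mathbb{C}\to\mathcal{D}$. Write $s=_c t$ for $V(s,c)=V(t,c)$ and $s=_C t$ if this holds for all $c\in C$. Semantics: booleans as usual; $\mathcal{M},s\vDash\mathit{Kv}(c)$ iff $s=_c t$ for all $t\in S$; $\mathcal{M},s\vDash[c]\varphi$ iff $\mathcal{M}|^s_c,s\vDash\varphi$, where $\mathcal{M}|^s_c=\langle S',\mathcal{D},V|_{S'\times\mathbb{C}}\rangle$ with $S'=\{t\in S\mid s=_c t\}$. For finite sets $C=\{c_1,\dots,c_m\}$, $D=\{d_1,\dots,d_n\}\subseteq\mathbb{C}$ define $\mathit{Kv}(C,D):=[c_1]\dots[c_m](\mathit{Kv}(d_1)\land\dots\land\mathit{Kv}(d_n))$ (an empty prefix of boxes is omitted; an empty conjunction is $\top$). The language $\mathcal{L}_2$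 is given by $\varphi ::= \top\mid\lnot\varphi\mid\varphi\land\varphi\mid\mathit{Kv}(C,D)$ with $C,D$ finite subsets of $\mathbb{C}$, regarded as formulas of $\mathcal{L}_1$ via this abbreviation. -}

module Defs where

open import Data.List using (List; []; _∷_)
open import Data.Product using (Σ; _,_; _×_)
open import Data.Unit using (⊤)
open import Relation.Binary.PropositionalEquality using (_≡_; refl)
open import Relation.Nullary using (¬_)

-- A model ⟨S, 𝒟, V⟩ over the set of constants ℂ.
-- Non-emptiness of S and of 𝒟 is recorded by witnesses.
record Model (ℂ : Set) : Set₁ where
  field
    S   : Set
    Dom : Set
    s₀  : S
    d₀  : Dom
    V   : S → ℂ → Dom
open Model public

data L1 (ℂ : Set) : Set where
  ⊤'   : L1 ℂ
  ¬'_  : L1 ℂ → L1 ℂ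
  _∧'_ : L1 ℂ → L1 ℂ → L1 ℂ
  Kv   : ℂ → L1 ℂ
  [_]_ : ℂ → L1 ℂ → L1 ℂ

_=[_]_ : ∀ {ℂ} {M : Model ℂ} → S M → ℂ → S M → Set
_=[_]_ {M = M} s c t = V M s c ≡ V M t c

restrict : ∀ {ℂ} (M : Model ℂ) → S M → ℂ → Model ℂ
restrict M s c = record
  { S   = Σ (S M) (λ t → V M s c ≡ V M t c)
  ; Dom = Dom M
  ; s₀  = s , refl
  ; d₀  = d₀ M
  ; V   = λ t c' → V M (Data.Product.proj₁ t) c'
  }

_,_⊨_ : ∀ {ℂ} (M : Model ℂ) → S M → L1 ℂ → Set
M , s ⊨ ⊤'      = ⊤
M , s ⊨ (¬' φ)  = ¬ (M , s ⊨ φ)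
M , s ⊨ (φ ∧' ψ) = (M , s ⊨ φ) × (M , s ⊨ ψ)
M , s ⊨ Kv c    = ∀ (t : S M) → V M s c ≡ V M t c
M , s ⊨ ([ c ] φ) = restrict M s c , (s , refl) ⊨ φ

-- Finite sets of constants are represented by lists C = c₁ … cₘ.
-- Kv(d₁) ∧ … ∧ Kv(dₙ)  (empty conjunction is ⊤)
KvAll : ∀ {ℂ} → List ℂ → L1 ℂ
KvAll []           = ⊤'
KvAll (d ∷ [])     = Kv d
KvAll (d ∷ e ∷ ds) = Kv d ∧' KvAll (e ∷ ds)

boxes : ∀ {ℂ} → List ℂ → L1 ℂ → L1 ℂ
boxes []      φ = φ
boxes (c ∷ C) φ = [ c ] boxes C φ

KvCD : ∀ {ℂ} → List ℂ → List ℂ → L1 ℂ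
KvCD C D = boxes C (KvAll D)

data L2 (ℂ : Set) : Set where
  ⊤'   : L2 ℂ
  ¬'_  : L2 ℂ → L2 ℂ
  _∧'_ : L2 ℂ → L2 ℂ → L2 ℂ
  Kv₂  : List ℂ → List ℂ → L2 ℂ

embed : ∀ {ℂ} → L2 ℂ → L1 ℂ
embed ⊤'         = ⊤'
embed (¬' φ)     = ¬' embed φ
embed (φ ∧' ψ)   = embed φ ∧' embed ψ
embed (Kv₂ C D)  = KvCD C D

module Submission where

-- Evaluating [c]φ at (M, s) just evaluates φ at a different pointed model, so [c]
-- commutes with ⊤, ¬ and ∧. Pushing the boxes of an L1 formula down to its atoms
-- therefore leaves only formulas [c₁]…[cₘ]Kv(d), i.e. Kv({c₁,…,cₘ},{d}).

open import Defs
open import Data.List using ([]; _∷_)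
open import Data.Product using (Σ; _,_)
open import Data.Product.Function.NonDependent.Propositional using (_×-⇔_)
open import Function.Bundles using (_⇔_)
open import Function.Properties.Equivalence using (refl; trans)
open import Function.Related.TypeIsomorphisms using (¬-cong-⇔)
open import Relation.Binary.PropositionalEquality as ≡ using ()

box : ∀ {ℂ} → ℂ → L2 ℂ → L2 ℂ
box c ⊤'        = ⊤'
box c (¬' φ)    = ¬' box c φ
box c (φ ∧' ψ)  = box c φ ∧' box c ψ
box c (Kv₂ C D) = Kv₂ (c ∷ C) D

⊨-box : ∀ {ℂ} (c : ℂ) (φ : L2 ℂ) (M : Model ℂ) (s : S M) →
        (M , s ⊨ ([ c ] embed φ)) ⇔ (M , s ⊨ embed (box c φ))
⊨-box c ⊤'        M s = refl
⊨-box c (¬' φ)    M s = ¬-cong-⇔ (⊨-box c φ M s)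
⊨-box c (φ ∧' ψ)  M s = ⊨-box c φ M s ×-⇔ ⊨-box c ψ M s
⊨-box c (Kv₂ C D) M s = refl

translate : ∀ {ℂ} → L1 ℂ → L2 ℂ
translate ⊤'        = ⊤'
translate (¬' φ)    = ¬' translate φ
translate (φ ∧' ψ)  = translate φ ∧' translate ψ
translate (Kv c)    = Kv₂ [] (c ∷ [])
translate ([ c ] φ) = box c (translate φ)

⊨-translate : ∀ {ℂ} (φ : L1 ℂ) (M : Model ℂ) (s : S M) →
              (M , s ⊨ φ) ⇔ (M , s ⊨ embed (translate φ))
⊨-translate ⊤'        M s = refl
⊨-translate (¬' φ)    M s = ¬-cong-⇔ (⊨-translate φ M s)
⊨-translate (φ ∧' ψ)  M s = ⊨-translate φ M s ×-⇔ ⊨-translate ψ M s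
⊨-translate (Kv c)    M s = refl
⊨-translate ([ c ] φ) M s =
  trans (⊨-translate φ (restrict M s c) (s , ≡.refl))
        (⊨-box c (translate φ) M s)

lemma2 : ∀ {ℂ : Set} (φ : L1 ℂ) → Σ (L2 ℂ) (λ tφ → ∀ (M : Model ℂ) (s : S M) → (M , s ⊨ φ) ⇔ (M , s ⊨ embed tφ))
lemma2 φ = translate φ , ⊨-translate φ
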